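{- Let $G$ be a finite graph, let $B,C\subseteq V(G)$ with $C\subseteq B$, and let $uv$ be an edge of $G$ with $\{u,v\}\subseteq C$. Then \[ \gamma_g(G_{uv}|B) \le \gamma_g(G|C) \quad\text{and}\quad \gamma_g^\prime(G_{uv}|B)\le \gamma_g^\prime(G|C). \]
   Context: Domination game: Dominator and Staller alternately choose vertices; a chosen vertex must dominate at least one vertex not yet dominated; the game ends when no legal move exists; Dominator minimizes and Staller maximizes the number of moves. For $S\subseteq V(G)$, $G|S$ is $G$ with the vertices of $S$ declared already dominated; $\gamma_g(G|S)$ (resp. $\gamma_g^\prime(G|S)$) is the number of remaining moves under optimal play when Dominator (resp. Staller) moves first. For an edge $uv$, $G_{uv}$ is obtained from $G-uv$ by adding new vertices $u',v'$ and edges $uv'$, $vu'$, with $u',v'$ declared dominated; $G_{uv}|B$ is $G_{uv}$ with $B\cup\{u',v'\}$ declared dominated. -}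

module Defs where

open import Data.Nat using (ℕ; zero; suc; _⊓_; _⊔_)
open import Data.Bool using (Bool; true; false; _∧_; _∨_; not)
open import Data.Fin using (Fin; zero; suc; _≟_)
open import Data.Fin.Subset using (Subset; inside; outside)
open import Data.Vec using (lookup)
open import Data.List using (List; []; _∷_; map; foldr; filterᵇ; allFin)
open import Data.Bool.ListAction using (any)
open import Relation.Nullary.Decidable using (⌊_⌋)
open import Relation.Binary.PropositionalEquality using (_≡_)

Adj : ℕ → Set
Adj n = Fin n → Fin n → Bool

record Graph (n : ℕ) : Set where
  field
    adj    : Adj n
    sym    : ∀ x y → adj x y ≡ adj y x
    irrefl : ∀ x → adj x x ≡ false
open Graph public

-- Set of already-dominated vertices, as a Boolean predicate.
Dom : ℕ → Set
Dom n = Fin n → Bool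

toDom : ∀ {n} → Subset n → Dom n
toDom S x with lookup S x
... | inside  = true
... | outside = false

closedN : ∀ {n} → Adj n → Fin n → Fin n → Bool
closedN a x y = ⌊ x ≟ y ⌋ ∨ a x y

legal : ∀ {n} → Adj n → Dom n → Fin n → Bool
legal {n} a D x = any (λ y → closedN a x y ∧ not (D y)) (allFin n)

play : ∀ {n} → Adj n → Dom n → Fin n → Dom n
play a D x y = D y ∨ closedN a x y

data Player : Set where
  Dominator Staller : Player

other : Player → Player
other Dominator = Staller
other Staller   = Dominator

-- Combine the values of the legal moves: no legal move = game over (0);
-- otherwise one move plus the min (Dominator) / max (Staller) continuation.
best : Player → List ℕ → ℕ
best _         []       = 0
best Dominator (v ∷ vs) = suc (foldr _⊓_ v vs)
best Staller   (v ∷ vs) = suc (foldr _⊔_ v vs)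

-- Number of remaining moves under optimal play, with `fuel` as an upper
-- bound on the game length (each move dominates at least one new vertex,
-- so fuel = number of vertices is always sufficient and gives the exact value).
gameVal : ∀ {n} → Adj n → ℕ → Player → Dom n → ℕ
gameVal a zero     p D = 0
gameVal {n} a (suc k) p D =
  best p (map (λ x → gameVal a k (other p) (play a D x))
              (filterᵇ (legal a D) (allFin n)))

γg : ∀ {n} → Adj n → Dom n → ℕ
γg {n} a D = gameVal a n Dominator D

γg′ : ∀ {n} → Adj n → Dom n → ℕ
γg′ {n} a D = gameVal a n Staller D

-- The graph G_uv on vertex set Fin (suc (suc n)):
--   zero = u',  suc zero = v',  suc (suc x) = original vertex x.
-- Edges: those of G except uv, plus u'v and v'u.

Gᵤᵥ : ∀ {n} → Graph n → Fin n → Fin n → Adj (suc (suc n))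
Gᵤᵥ G u v zero          zero          = false
Gᵤᵥ G u v zero          (suc zero)    = false
Gᵤᵥ G u v zero          (suc (suc y)) = ⌊ y ≟ v ⌋
Gᵤᵥ G u v (suc zero)    zero          = false
Gᵤᵥ G u v (suc zero)    (suc zero)    = false
Gᵤᵥ G u v (suc zero)    (suc (suc y)) = ⌊ y ≟ u ⌋
Gᵤᵥ G u v (suc (suc x)) zero          = ⌊ x ≟ v ⌋
Gᵤᵥ G u v (suc (suc x)) (suc zero)    = ⌊ x ≟ u ⌋
Gᵤᵥ G u v (suc (suc x)) (suc (suc y)) =
  adj G x y ∧ not ((⌊ x ≟ u ⌋ ∧ ⌊ y ≟ v ⌋) ∨ (⌊ x ≟ v ⌋ ∧ ⌊ y ≟ u ⌋))

domᵤᵥ : ∀ {n} → Subset n → Dom (suc (suc n))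
domᵤᵥ B zero          = true
domᵤᵥ B (suc zero)    = true
domᵤᵥ B (suc (suc x)) = toDom B x

module Submission where

-- The closed neighbourhoods of an original vertex in G_uv and in G differ only
-- in u, v, u′ and v′, and N[u′] = {u′, v}, N[v′] = {v′, u}.  Since u, v ∈ C ⊆ B,
-- all four are dominated in G_uv|B, so u′ and v′ are never legal and every
-- original vertex dominates the same new vertices in both graphs: the games on
-- G_uv|B and on G|B coincide move by move.  Declaring the vertices of B ∖ C
-- dominated can only shorten the game (continuation principle), which gives the
-- comparison with G|C.  Values are computed with fuel; as every move dominates a
-- new vertex, fuel beyond the number of undominated vertices changes nothing.

open import Defs hiding (sym)
open import Data.Nat using (ℕ; _≤_; _<_; zero; suc; _⊓_; _⊔_; z≤n; s≤s)
open import Data.Nat.Properties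
  using (≤-trans; ≤-antisym; ≤-reflexive; m≤n⇒m≤1+n; <-≤-trans; m<1+n⇒m≤n; n≮0;
         module ≤-Reasoning; ⊓-glb; ⊔-lub; m≤n⇒m⊓o≤n; m≤n⇒o⊓m≤n; m≤n⇒m≤n⊔o; m≤n⇒m≤o⊔n)
open import Data.Bool using (Bool; true; false; _∧_; _∨_; not; if_then_else_; T)
open import Data.Bool.Properties using (T-∧; ∧-zeroʳ; ∧-identityʳ)
open import Data.Unit using (tt)
open import Data.Fin using (Fin; zero; suc; _≟_)
open import Data.Fin.Subset using (Subset; _⊆_; _∈_)
open import Data.Vec using (lookup)
open import Data.Vec.Properties using ([]=⇒lookup; lookup⇒[]=)
open import Data.List using (List; []; _∷_; map; foldr; filterᵇ; allFin; tabulate; length)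
open import Data.Bool.ListAction using (any; or)
open import Data.List.Properties
  using (map-cong; map-cong-local; map-∘; map-tabulate; length-tabulate;
         foldr-preservesᵇ; foldr-preservesᵒ; filter-none; filter-reject)
open import Data.List.Relation.Unary.All as All using (All; []; _∷_)
open import Data.List.Relation.Unary.All.Properties using (all-filter)
open import Data.List.Relation.Unary.Any as Any using (Any; here; there)
import Data.List.Relation.Unary.Any.Properties as Any
open import Data.List.Membership.Propositional using (lose) renaming (_∈_ to _∈ˡ_)
open import Data.List.Membership.Propositional.Properties
  using (∈-map⁺; ∈-filter⁺; ∈-map∘filter⁻; ∈-allFin)
open import Data.Product using (_×_; _,_; ∃-syntax)
open import Data.Sum using (_⊎_; inj₁; inj₂; [_,_])
open import Data.Empty using (⊥-elim)
open import Function using (_∘_; Equivalence)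
open import Relation.Nullary using (¬_; yes; no)
open import Relation.Nullary.Decidable using (⌊_⌋; T?)
open import Relation.Binary.PropositionalEquality
  using (_≡_; _≗_; refl; sym; trans; cong; cong₂; subst; module ≡-Reasoning)

private variable
  A : Set
  n : ℕ
  D E F : A → Bool

_⊑_ : (A → Bool) → (A → Bool) → Set
D ⊑ E = ∀ x → T (D x) → T (E x)

⊑-trans : D ⊑ E → E ⊑ F → D ⊑ F
⊑-trans D⊑E E⊑F x = E⊑F x ∘ D⊑E x

≗⇒⊑ : D ≗ E → D ⊑ E
≗⇒⊑ D≗E x = subst T (D≗E x)

⊑-∨ˡ : D ⊑ (λ x → D x ∨ E x)
⊑-∨ˡ {D = D} x t with D x
... | true = tt

⊑-∨ʳ : E ⊑ (λ x → D x ∨ E x)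
⊑-∨ʳ {D = D} x t with D x
... | true  = tt
... | false = t

∨-lub : D ⊑ F → E ⊑ F → (λ x → D x ∨ E x) ⊑ F
∨-lub {D = D} D⊑F E⊑F x with D x | D⊑F x
... | true  | f = f
... | false | _ = E⊑F x

¬T⇒T-not : ∀ {b} → ¬ T b → T (not b)
¬T⇒T-not {true}  ¬t = ¬t tt
¬T⇒T-not {false} _  = tt

T-not⇒¬T : ∀ {b} → T (not b) → ¬ T b
T-not⇒¬T {true} ()

∨-cong-unless : ∀ {a b c} → T a ⊎ b ≡ c → a ∨ b ≡ a ∨ c
∨-cong-unless {true}  _          = refl
∨-cong-unless {false} (inj₂ b≡c) = b≡c

∧-not-cong-unless : ∀ {a b c} → T a ⊎ b ≡ c → b ∧ not a ≡ c ∧ not a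
∧-not-cong-unless {true}  {b} {c} _ = trans (∧-zeroʳ b) (sym (∧-zeroʳ c))
∧-not-cong-unless {false}         (inj₂ b≡c) = cong (_∧ true) b≡c

filterᵇ-map : ∀ {B : Set} {p : B → Bool} {q : A → Bool} (g : A → B) → p ∘ g ≗ q →
              ∀ xs → filterᵇ p (map g xs) ≡ map g (filterᵇ q xs)
filterᵇ-map g pg≗q [] = refl
filterᵇ-map {q = q} g pg≗q (x ∷ xs) rewrite pg≗q x with q x
... | true  = cong (g x ∷_) (filterᵇ-map g pg≗q xs)
... | false = filterᵇ-map g pg≗q xs

undominated : (A → Bool) → List A → ℕ
undominated D []       = 0
undominated D (x ∷ xs) = if D x then undominated D xs else suc (undominated D xs)

undominated-≤-length : ∀ (D : A → Bool) xs → undominated D xs ≤ length xs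
undominated-≤-length D []       = z≤n
undominated-≤-length D (x ∷ xs) with D x
... | true  = m≤n⇒m≤1+n (undominated-≤-length D xs)
... | false = s≤s (undominated-≤-length D xs)

undominated-antitone : D ⊑ E → ∀ xs → undominated E xs ≤ undominated D xs
undominated-antitone D⊑E [] = z≤n
undominated-antitone {D = D} {E = E} D⊑E (x ∷ xs) with D x | E x | D⊑E x
... | true  | true  | _ = undominated-antitone D⊑E xs
... | true  | false | f = ⊥-elim (f tt)
... | false | true  | _ = m≤n⇒m≤1+n (undominated-antitone D⊑E xs)
... | false | false | _ = s≤s (undominated-antitone D⊑E xs)

undominated-< : D ⊑ E → ∀ {xs} → Any (λ y → T (E y) × ¬ T (D y)) xs →
                undominated E xs < undominated D xs
undominated-< {D = D} {E = E} D⊑E {x ∷ xs} (here (e , ¬d)) with D x | E x | e | ¬d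
... | true  | _     | _  | ¬d = ⊥-elim (¬d tt)
... | false | true  | _  | _  = s≤s (undominated-antitone D⊑E xs)
undominated-< {D = D} {E = E} D⊑E {x ∷ xs} (there p) with D x | E x | D⊑E x
... | true  | true  | _ = undominated-< D⊑E p
... | true  | false | f = ⊥-elim (f tt)
... | false | true  | _ = m≤n⇒m≤1+n (undominated-< D⊑E p)
... | false | false | _ = s≤s (undominated-< D⊑E p)

foldr-⊓-≤ : ∀ {y} w ws → Any (_≤ y) (w ∷ ws) → foldr _⊓_ w ws ≤ y
foldr-⊓-≤ {y} w ws =
  foldr-preservesᵒ {P = _≤ y} (λ a b → [ m≤n⇒m⊓o≤n b , m≤n⇒o⊓m≤n a ]) w ws ∘ Any.toSum

≤-foldr-⊔ : ∀ {x} w ws → Any (x ≤_) (w ∷ ws) → x ≤ foldr _⊔_ w ws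
≤-foldr-⊔ {x} w ws =
  foldr-preservesᵒ {P = x ≤_} (λ a b → [ m≤n⇒m≤n⊔o b , m≤n⇒m≤o⊔n a ]) w ws ∘ Any.toSum

best-Staller-mono : ∀ {xs ys} → All (λ x → Any (x ≤_) ys) xs →
                    best Staller xs ≤ best Staller ys
best-Staller-mono {[]}             _           = z≤n
best-Staller-mono {w ∷ ws} {[]}    (() ∷ _)
best-Staller-mono {w ∷ ws} {y ∷ ys} (h ∷ hs) =
  s≤s (foldr-preservesᵇ ⊔-lub (≤-foldr-⊔ y ys h) (All.map (≤-foldr-⊔ y ys) hs))

best-Dominator-mono : ∀ {xs ys} →
  (∀ {x} → x ∈ˡ xs → ∃[ y ] y ∈ˡ ys) →
  (∀ {x} → x ∈ˡ xs → All (λ y → Any (_≤ y) xs) ys) →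
  best Dominator xs ≤ best Dominator ys
best-Dominator-mono {[]}             _        _     = z≤n
best-Dominator-mono {w ∷ ws} {[]}    nonempty _     with nonempty (here refl)
... | _ , ()
best-Dominator-mono {w ∷ ws} {y ∷ ys} _       cover with All.map (foldr-⊓-≤ w ws) (cover (here refl))
... | p ∷ ps = s≤s (foldr-preservesᵇ ⊓-glb p ps)

module _ {n} (a : Adj n) where

  valueAfter : ℕ → Player → Dom n → Fin n → ℕ
  valueAfter k p D x = gameVal a k (other p) (play a D x)

  options : ℕ → Player → Dom n → List ℕ
  options k p D = map (valueAfter k p D) (filterᵇ (legal a D) (allFin n))

  play-extends : ∀ {D x} → D ⊑ play a D x
  play-extends {D} {x} = ⊑-∨ˡ {D = D} {E = closedN a x}

  closedN⊑play : ∀ {D x} → closedN a x ⊑ play a D x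
  closedN⊑play {D} = ⊑-∨ʳ {D = D}

  play-lub : ∀ {D F x} → D ⊑ F → closedN a x ⊑ F → play a D x ⊑ F
  play-lub {D} = ∨-lub {D = D}

  play-mono : ∀ {D E x} → D ⊑ E → play a D x ⊑ play a E x
  play-mono {E = E} {x} D⊑E = play-lub (⊑-trans D⊑E (play-extends {E} {x})) (closedN⊑play {E})

  legal⁺ : ∀ {D x} y → T (closedN a x y) → ¬ T (D y) → T (legal a D x)
  legal⁺ y c ¬d = Any.any⁺ _ (Any.tabulate⁺ y (Equivalence.from T-∧ (c , ¬T⇒T-not ¬d)))

  legal⁻ : ∀ {D x} → T (legal a D x) → ∃[ y ] T (closedN a x y) × ¬ T (D y)
  legal⁻ l with Any.tabulate⁻ (Any.any⁻ _ _ l)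
  ... | y , t with Equivalence.to T-∧ t
  ...   | c , d = y , c , T-not⇒¬T d

  ¬legal⇒closedN⊑ : ∀ {D x} → ¬ T (legal a D x) → closedN a x ⊑ D
  ¬legal⇒closedN⊑ {D} ¬l y c with T? (D y)
  ... | yes d = d
  ... | no ¬d = ⊥-elim (¬l (legal⁺ y c ¬d))

  closedN⊑⇒¬legal : ∀ {D x} → closedN a x ⊑ D → ¬ T (legal a D x)
  closedN⊑⇒¬legal N⊑D l with legal⁻ l
  ... | y , c , ¬d = ¬d (N⊑D y c)

  legal-antitone : ∀ {D E x} → D ⊑ E → T (legal a E x) → T (legal a D x)
  legal-antitone D⊑E l with legal⁻ l
  ... | y , c , ¬e = legal⁺ y c (¬e ∘ D⊑E y)

  undominated-play-< : ∀ {D x} → T (legal a D x) →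
                  undominated (play a D x) (allFin n) < undominated D (allFin n)
  undominated-play-< {D} {x} l with legal⁻ l
  ... | y , c , ¬d = undominated-< play-extends (Any.tabulate⁺ y (closedN⊑play {D} {x} y c , ¬d))

  ∈-options⁺ : ∀ k p {D x} → T (legal a D x) → valueAfter k p D x ∈ˡ options k p D
  ∈-options⁺ k p {D} {x} l = ∈-map⁺ (valueAfter k p D) (∈-filter⁺ (T? ∘ legal a D) (∈-allFin x) l)

  ∈-options⁻ : ∀ k p D {w} → w ∈ˡ options k p D →
               ∃[ x ] T (legal a D x) × w ≡ valueAfter k p D x
  ∈-options⁻ k p D w∈ with ∈-map∘filter⁻ (valueAfter k p D) (T? ∘ legal a D) {xs = allFin n} w∈
  ... | x , _ , w≡ , l = x , l , w≡

  gameVal-fuel : ∀ k p D → undominated D (allFin n) ≤ k →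
                 gameVal a (suc k) p D ≡ gameVal a k p D
  gameVal-fuel zero p D none =
    cong (best p ∘ map (valueAfter zero p D))
      (filter-none (T? ∘ legal a D) (All.universal noMove (allFin n)))
    where
    noMove : ∀ x → ¬ T (legal a D x)
    noMove x l = n≮0 (<-≤-trans (undominated-play-< l) none)
  gameVal-fuel (suc k) p D few =
    cong (best p) (map-cong-local (All.map fuelEnough (all-filter (T? ∘ legal a D) (allFin n))))
    where
    fuelEnough : ∀ {x} → T (legal a D x) → valueAfter (suc k) p D x ≡ valueAfter k p D x
    fuelEnough {x} l = gameVal-fuel k (other p) (play a D x) (m<1+n⇒m≤n (<-≤-trans (undominated-play-< l) few))

  gameVal-antitone : ∀ k p {D E} → D ⊑ E → gameVal a k p E ≤ gameVal a k p D
  gameVal-antitone zero    p        _   = z≤n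
  gameVal-antitone (suc k) Staller {D} {E} D⊑E = best-Staller-mono (All.tabulate answer)
    where
    answer : ∀ {w} → w ∈ˡ options k Staller E → Any (w ≤_) (options k Staller D)
    answer w∈ with ∈-options⁻ k Staller E w∈
    ... | x , l , refl =
      lose (∈-options⁺ k Staller (legal-antitone D⊑E l))
           (gameVal-antitone k Dominator (play-mono {D} {E} {x} D⊑E))
  gameVal-antitone (suc k) Dominator {D} {E} D⊑E = best-Dominator-mono nonempty cover
    where
    nonempty : ∀ {w} → w ∈ˡ options k Dominator E → ∃[ v ] v ∈ˡ options k Dominator D
    nonempty w∈ with ∈-options⁻ k Dominator E w∈
    ... | _ , l , _ = _ , ∈-options⁺ k Dominator (legal-antitone D⊑E l)
    cover : ∀ {w} → w ∈ˡ options k Dominator E →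
            All (λ v → Any (_≤ v) (options k Dominator E)) (options k Dominator D)
    cover w∈ with ∈-options⁻ k Dominator E w∈
    ... | x₀ , l₀ , _ = All.tabulate answer
      where
      answer : ∀ {v} → v ∈ˡ options k Dominator D → Any (_≤ v) (options k Dominator E)
      answer v∈ with ∈-options⁻ k Dominator D v∈
      ... | x , _ , refl with T? (legal a E x)
      ... | yes l = lose (∈-options⁺ k Dominator l)
                      (gameVal-antitone k Staller (play-mono {D} {E} {x} D⊑E))
      -- x dominates nothing new in E, so any legal x₀ of E dominates at least as much.
      ... | no ¬l = lose (∈-options⁺ k Dominator l₀)
                      (gameVal-antitone k Staller (play-lub {D} {play a E x₀} {x} D⊑E′ N⊑E′))
        where
        D⊑E′ : D ⊑ play a E x₀
        D⊑E′ = ⊑-trans D⊑E play-extends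
        N⊑E′ : closedN a x ⊑ play a E x₀
        N⊑E′ = ⊑-trans (¬legal⇒closedN⊑ ¬l) play-extends

  gameVal-cong : ∀ k p {D E} → D ≗ E → gameVal a k p D ≡ gameVal a k p E
  gameVal-cong k p D≗E =
    ≤-antisym (gameVal-antitone k p (≗⇒⊑ (sym ∘ D≗E))) (gameVal-antitone k p (≗⇒⊑ D≗E))

old : Fin n → Fin (suc (suc n))
old x = suc (suc x)

liftDom : Dom n → Dom (suc (suc n))
liftDom D zero          = true
liftDom D (suc zero)    = true
liftDom D (suc (suc x)) = D x

allFin-2+ : allFin (suc (suc n)) ≡ zero ∷ suc zero ∷ map old (allFin n)
allFin-2+ = cong (λ xs → zero ∷ suc zero ∷ xs) (sym (map-tabulate (λ x → x) old))

module _ {n} (G : Graph n) (u v : Fin n) where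

  dominated-or-agrees : ∀ {D : Dom n} → T (D u) → T (D v) → ∀ i j →
    T (D j) ⊎ closedN (Gᵤᵥ G u v) (old i) (old j) ≡ closedN (adj G) i j
  dominated-or-agrees du dv i j with i ≟ j | j ≟ u | j ≟ v
  ... | _     | yes refl | _        = inj₁ du
  ... | _     | no _     | yes refl = inj₁ dv
  ... | yes _ | no _     | no _     = inj₂ refl
  ... | no _  | no _     | no _
    rewrite ∧-zeroʳ ⌊ i ≟ u ⌋ | ∧-zeroʳ ⌊ i ≟ v ⌋ = inj₂ (∧-identityʳ (adj G i j))

  play-liftDom : ∀ {D} → T (D u) → T (D v) → ∀ i →
                 play (Gᵤᵥ G u v) (liftDom D) (old i) ≗ liftDom (play (adj G) D i)
  play-liftDom du dv i zero          = refl
  play-liftDom du dv i (suc zero)    = refl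
  play-liftDom du dv i (suc (suc j)) = ∨-cong-unless (dominated-or-agrees du dv i j)

  legal-liftDom : ∀ {D} → T (D u) → T (D v) → ∀ i →
                  legal (Gᵤᵥ G u v) (liftDom D) (old i) ≡ legal (adj G) D i
  legal-liftDom {D} du dv i = begin
    any f (allFin (suc (suc n)))
      ≡⟨ cong (any f) allFin-2+ ⟩
    f zero ∨ f (suc zero) ∨ any f (map old (allFin n))
      ≡⟨ cong₂ (λ b c → b ∨ c ∨ any f (map old (allFin n)))
               (∧-zeroʳ (N zero)) (∧-zeroʳ (N (suc zero))) ⟩
    or (map f (map old (allFin n)))
      ≡⟨ cong or (sym (map-∘ (allFin n))) ⟩
    or (map (f ∘ old) (allFin n))
      ≡⟨ cong or (map-cong (λ j → ∧-not-cong-unless (dominated-or-agrees du dv i j)) (allFin n)) ⟩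
    legal (adj G) D i ∎
    where
    open ≡-Reasoning
    N f : Fin (suc (suc n)) → Bool
    N = closedN (Gᵤᵥ G u v) (old i)
    f y = N y ∧ not (liftDom D y)

  u′-illegal : ∀ {D} → T (D v) → ¬ T (legal (Gᵤᵥ G u v) (liftDom D) zero)
  u′-illegal {D} dv = closedN⊑⇒¬legal (Gᵤᵥ G u v) {liftDom D} {zero} N[u′]⊑
    where
    N[u′]⊑ : closedN (Gᵤᵥ G u v) zero ⊑ liftDom D
    N[u′]⊑ zero          = _
    N[u′]⊑ (suc zero)    = _
    N[u′]⊑ (suc (suc j)) with j ≟ v
    ... | yes refl = λ _ → dv
    ... | no _     = λ ()

  v′-illegal : ∀ {D} → T (D u) → ¬ T (legal (Gᵤᵥ G u v) (liftDom D) (suc zero))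
  v′-illegal {D} du = closedN⊑⇒¬legal (Gᵤᵥ G u v) {liftDom D} {suc zero} N[v′]⊑
    where
    N[v′]⊑ : closedN (Gᵤᵥ G u v) (suc zero) ⊑ liftDom D
    N[v′]⊑ zero          = _
    N[v′]⊑ (suc zero)    = _
    N[v′]⊑ (suc (suc j)) with j ≟ u
    ... | yes refl = λ _ → du
    ... | no _     = λ ()

  legalMoves-liftDom : ∀ {D} → T (D u) → T (D v) →
    filterᵇ (legal (Gᵤᵥ G u v) (liftDom D)) (allFin (suc (suc n)))
      ≡ map old (filterᵇ (legal (adj G) D) (allFin n))
  legalMoves-liftDom {D} du dv = begin
    filterᵇ L′ (allFin (suc (suc n)))
      ≡⟨ cong (filterᵇ L′) allFin-2+ ⟩
    filterᵇ L′ (zero ∷ suc zero ∷ map old (allFin n))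
      ≡⟨ filter-reject (T? ∘ L′) {zero} (u′-illegal {D} dv) ⟩
    filterᵇ L′ (suc zero ∷ map old (allFin n))
      ≡⟨ filter-reject (T? ∘ L′) {suc zero} (v′-illegal {D} du) ⟩
    filterᵇ L′ (map old (allFin n))
      ≡⟨ filterᵇ-map old (legal-liftDom du dv) (allFin n) ⟩
    map old (filterᵇ (legal (adj G) D) (allFin n)) ∎
    where
    open ≡-Reasoning
    L′ : Fin (suc (suc n)) → Bool
    L′ = legal (Gᵤᵥ G u v) (liftDom D)

  gameVal-liftDom : ∀ k p {D} → T (D u) → T (D v) →
                    gameVal (Gᵤᵥ G u v) k p (liftDom D) ≡ gameVal (adj G) k p D
  gameVal-liftDom zero    p du dv = refl
  gameVal-liftDom (suc k) p {D} du dv = cong (best p) (begin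
    map (valueAfter A′ k p (liftDom D)) (filterᵇ (legal A′ (liftDom D)) (allFin (suc (suc n))))
      ≡⟨ cong (map (valueAfter A′ k p (liftDom D))) (legalMoves-liftDom du dv) ⟩
    map (valueAfter A′ k p (liftDom D)) (map old (filterᵇ (legal (adj G) D) (allFin n)))
      ≡⟨ sym (map-∘ _) ⟩
    map (valueAfter A′ k p (liftDom D) ∘ old) (filterᵇ (legal (adj G) D) (allFin n))
      ≡⟨ map-cong valueAfter-liftDom _ ⟩
    options (adj G) k p D ∎)
    where
    open ≡-Reasoning
    A′ : Adj (suc (suc n))
    A′ = Gᵤᵥ G u v
    valueAfter-liftDom : ∀ i → valueAfter A′ k p (liftDom D) (old i) ≡ valueAfter (adj G) k p D i
    valueAfter-liftDom i = begin
      gameVal A′ k (other p) (play A′ (liftDom D) (old i))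
        ≡⟨ gameVal-cong A′ k (other p) (play-liftDom du dv i) ⟩
      gameVal A′ k (other p) (liftDom (play (adj G) D i))
        ≡⟨ gameVal-liftDom k (other p) (play-extends (adj G) {D} {i} u du)
                                       (play-extends (adj G) {D} {i} v dv) ⟩
      gameVal (adj G) k (other p) (play (adj G) D i) ∎

toDom⁺ : ∀ {S : Subset n} {x} → x ∈ S → T (toDom S x)
toDom⁺ {S = S} {x} x∈S with lookup S x | []=⇒lookup x∈S
... | .true | refl = _

toDom⁻ : ∀ {S : Subset n} {x} → T (toDom S x) → x ∈ S
toDom⁻ {S = S} {x} with lookup S x in eq
... | true = λ _ → lookup⇒[]= x S eq

toDom-⊑ : ∀ {B C : Subset n} → C ⊆ B → toDom C ⊑ toDom B
toDom-⊑ C⊆B x = toDom⁺ ∘ C⊆B ∘ toDom⁻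

domᵤᵥ≗liftDom : ∀ (B : Subset n) → domᵤᵥ B ≗ liftDom (toDom B)
domᵤᵥ≗liftDom B zero          = refl
domᵤᵥ≗liftDom B (suc zero)    = refl
domᵤᵥ≗liftDom B (suc (suc x)) = refl

undominated-domᵤᵥ : ∀ (B : Subset n) → undominated (domᵤᵥ B) (allFin (suc (suc n))) ≤ n
undominated-domᵤᵥ B =
  ≤-trans (undominated-≤-length (domᵤᵥ B) (tabulate old)) (≤-reflexive (length-tabulate old))

lemma6p1 : ∀ {n} (G : Graph n) (B C : Subset n) (u v : Fin n) →
    C ⊆ B → adj G u v ≡ true → u ∈ C → v ∈ C →
    (γg (Gᵤᵥ G u v) (domᵤᵥ B) ≤ γg (adj G) (toDom C))
      × (γg′ (Gᵤᵥ G u v) (domᵤᵥ B) ≤ γg′ (adj G) (toDom C))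
lemma6p1 {n} G B C u v C⊆B _ u∈C v∈C = bound Dominator , bound Staller
  where
  A′ : Adj (suc (suc n))
  A′ = Gᵤᵥ G u v
  fuel : undominated (domᵤᵥ B) (allFin (suc (suc n))) ≤ n
  fuel = undominated-domᵤᵥ B
  bound : ∀ p → gameVal A′ (suc (suc n)) p (domᵤᵥ B) ≤ gameVal (adj G) n p (toDom C)
  bound p = begin
    gameVal A′ (suc (suc n)) p (domᵤᵥ B)
      ≡⟨ gameVal-fuel A′ (suc n) p (domᵤᵥ B) (m≤n⇒m≤1+n fuel) ⟩
    gameVal A′ (suc n) p (domᵤᵥ B)
      ≡⟨ gameVal-fuel A′ n p (domᵤᵥ B) fuel ⟩
    gameVal A′ n p (domᵤᵥ B)
      ≡⟨ gameVal-cong A′ n p (domᵤᵥ≗liftDom B) ⟩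
    gameVal A′ n p (liftDom (toDom B))
      ≡⟨ gameVal-liftDom G u v n p (toDom⁺ (C⊆B u∈C)) (toDom⁺ (C⊆B v∈C)) ⟩
    gameVal (adj G) n p (toDom B)
      ≤⟨ gameVal-antitone (adj G) n p (toDom-⊑ C⊆B) ⟩
    gameVal (adj G) n p (toDom C) ∎
    where open ≤-Reasoning
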